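{- Let $0<\epsilon<1$, $\beta=2+3\epsilon$, and $L=2+\lceil\log_{1+\epsilon}n\rceil$. Let $G=(V,E)$ be an $n$-node graph with maximum degree at most $\Delta$ and arboricity at most $\alpha$, let $e\in E$, let $(Z_i)_{i\in[L]}$ be a $(\beta,2(1+\epsilon)\alpha,L)$-decomposition of $G$, and let $\chi$ be a proper edge coloring of $G-e$ (i.e., of all edges except $e$, which is uncolored) with colors in $[\Delta+2\beta(1+\epsilon)\alpha]$. Then running the procedure ExtendColoring$(e,(Z_i)_i)$ (with arbitrary choices wherever the procedure allows a choice): (1) changes the colors of at most $L$ edges of $G$, and (2) turns $\chi$ into a proper edge coloring of $G$ with colors in $[\Delta+2\beta(1+\epsilon)\alpha]$.
   Context: A $(\beta,d,L)$-decomposition of $G$ is a sequence of node sets $Z_L\subseteq\dots\subseteq Z_1=V$ such that for every $i\in[L-1]$, every $u\in Z_i$ with $\deg_{G[Z_i]}(u)>\beta d$ lies in $Z_{i+1}$ and no $u\in Z_i$ with $\deg_{G[Z_i]}(u)<d$ lies in $Z_{i+1}$. With $V_i=Z_i\setminus Z_{i+1}$ ($i<L$) and $V_L=Z_L$, the level $\ell(u)$ of $u$ is the $i$ with $u\in V_i$. Each edge $(u,v)$ is oriented from its endpoint of lower level to its endpoint of higher level (arbitrarily if equal); write $u\prec v$ if it is oriented from $u$ to $v$. $N(w)$ is the set of edges incident to $w$ in $G$, and $N^+(u)$ is the set of edges incident to $u$ in the induced subgraph $G[Z_{\ell(u)}]$. For a set $F$ of edges, $\chi(F)$ is the set of colors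 assigned by $\chi$ to (colored) edges of $F$. The arboricity of $G$ is the smallest integer $\alpha$ with $\lceil|E(G[S])|/(|S|-1)\rceil\le\alpha$ for all $S\subseteq V$, $|S|\ge 2$; $[k]=\{1,\dots,\lfloor k\rfloor\}$. Procedure ExtendColoring$(e,(Z_i)_i)$: set $S=\{e\}$. While $S\ne\varnothing$: pick any $f=(u,v)\in S$ with $u\prec v$; let $C_u^+=\chi(N^+(u))$ and $C_v=\chi(N(v))$; let $c$ be any element of $[|C_u^+|+|C_v|+1]\setminus(C_u^+\cup C_v)$; if some edge $f'\in N(u)$ has $\chi(f')=c$, uncolor $f'$ and add it to $S$; set $\chi(f)=c$ and remove $f$ from $S$.
   Formalization: The parameter ε ranges over the rationals strictly between 0 and 1. -}

module Defs where

open import Level using (0ℓ)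
open import Data.Nat as ℕ using (ℕ; zero; suc; _+_; _∸_; _≤_; _<_)
open import Data.Nat.DivMod using (_/_)
open import Data.Integer as ℤ using (ℤ; +_)
open import Data.Rational as ℚ using (ℚ; 0ℚ; 1ℚ; floor)
open import Data.Fin using (Fin; toℕ)
open import Data.Fin.Properties using () renaming (_≟_ to _≟ᶠ_)
open import Data.Fin.Subset using (Subset; _∈_; _∉_; _⊆_; ⊤; ∣_∣)
open import Data.Vec using (lookup)
open import Data.Bool using (Bool; true; false; _∧_; _∨_; if_then_else_; T)
open import Data.Maybe using (Maybe; just; nothing)
open import Data.List using (List; []; _∷_; [_]; _++_; length; map; filterᵇ; allFin;
                             cartesianProduct; catMaybes; deduplicate)
open import Data.Bool.ListAction using (any)
open import Data.List.Membership.Propositional using () renaming (_∈_ to _∈ˡ_)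
open import Data.Product using (Σ; ∃; _×_; _,_; proj₁; proj₂)
open import Data.Sum using (_⊎_)
open import Relation.Binary.PropositionalEquality using (_≡_; _≢_)
open import Relation.Nullary using (¬_; does)
open import Induction.WellFounded using (Acc)

record Graph (n : ℕ) : Set where
  field
    adj     : Fin n → Fin n → Bool
    adj-sym : ∀ u v → adj u v ≡ adj v u
    adj-irr : ∀ u → adj u u ≡ false
open Graph public

-- An edge is written as an ordered pair (u , v) of adjacent vertices;
-- (u , v) and (v , u) denote the same (undirected) edge.
Edge : ℕ → Set
Edge n = Fin n × Fin n

_≡ᶠᵇ_ : ∀ {n} → Fin n → Fin n → Bool
x ≡ᶠᵇ y = does (x ≟ᶠ y)

sameᵇ : ∀ {n} → Edge n → Edge n → Bool
sameᵇ (x , y) (a , b) = (x ≡ᶠᵇ a ∧ y ≡ᶠᵇ b) ∨ (x ≡ᶠᵇ b ∧ y ≡ᶠᵇ a)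

SameEdge : ∀ {n} → Edge n → Edge n → Set
SameEdge (x , y) (a , b) = (x ≡ a × y ≡ b) ⊎ (x ≡ b × y ≡ a)

-- degree of u in the induced subgraph G[Z] (u ∈ Z is assumed by callers)
degIn : ∀ {n} → Graph n → Subset n → Fin n → ℕ
degIn {n} G Z u = length (filterᵇ (λ w → lookup Z w ∧ adj G u w) (allFin n))

deg : ∀ {n} → Graph n → Fin n → ℕ
deg G u = degIn G ⊤ u

MaxDegreeAtMost : ∀ {n} → Graph n → ℕ → Set
MaxDegreeAtMost G Δ = ∀ u → deg G u ≤ Δ

-- unordered pairs {x , y}, listed once as (x , y) with x < y
upairs : ∀ n → List (Edge n)
upairs n = filterᵇ (λ p → toℕ (proj₁ p) ℕ.<ᵇ toℕ (proj₂ p))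
                   (cartesianProduct (allFin n) (allFin n))

edgesIn : ∀ {n} → Graph n → Subset n → List (Edge n)
edgesIn {n} G S =
  filterᵇ (λ p → lookup S (proj₁ p) ∧ lookup S (proj₂ p) ∧ adj G (proj₁ p) (proj₂ p))
          (upairs n)

-- ⌈ a / b ⌉ for natural numbers (only used with b ≥ 1)
ceilDiv : ℕ → ℕ → ℕ
ceilDiv a zero    = 0
ceilDiv a (suc k) = (a + k) / suc k

ArbBound : ∀ {n} → Graph n → ℕ → Set
ArbBound {n} G α = (S : Subset n) → 2 ≤ ∣ S ∣ →
  ceilDiv (length (edgesIn G S)) (∣ S ∣ ∸ 1) ≤ α

IsArboricity : ∀ {n} → Graph n → ℕ → Set
IsArboricity G a = ArbBound G a × (∀ b → ArbBound G b → a ≤ b)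

ArboricityAtMost : ∀ {n} → Graph n → ℕ → Set
ArboricityAtMost G α = Σ ℕ λ a → IsArboricity G a × a ≤ α

ℕtoℚ : ℕ → ℚ
ℕtoℚ m = (+ m) ℚ./ 1

pow : ℚ → ℕ → ℚ
pow b zero    = 1ℚ
pow b (suc k) = b ℚ.* pow b k

IsCeilLog : ℚ → ℕ → ℕ → Set
IsCeilLog b n k = (ℕtoℚ n ℚ.≤ pow b k) × (∀ j → j < k → pow b j ℚ.< ℕtoℚ n)

β : ℚ → ℚ
β ε = ℕtoℚ 2 ℚ.+ ℕtoℚ 3 ℚ.* ε

dval : ℚ → ℕ → ℚ
dval ε α = ℕtoℚ 2 ℚ.* (1ℚ ℚ.+ ε) ℚ.* ℕtoℚ α

-- Δ + 2 β (1 + ε) α  (the palette is [this] = {1, …, ⌊this⌋})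
paletteBound : ℚ → ℕ → ℕ → ℚ
paletteBound ε Δ α =
  ℕtoℚ Δ ℚ.+ ℕtoℚ 2 ℚ.* β ε ℚ.* (1ℚ ℚ.+ ε) ℚ.* ℕtoℚ α

InPalette : ℚ → ℕ → Set
InPalette q c = 1 ≤ c × (+ c) ℤ.≤ floor q

-- (β , d , L)-decompositions (indices 1 … L; values of Z outside are irrelevant)

IsDecomposition : ∀ {n} → Graph n → (β d : ℚ) (L : ℕ) → (ℕ → Subset n) → Set
IsDecomposition G b d L Z =
  (Z 1 ≡ ⊤) ×
  (∀ i → 1 ≤ i → i < L → Z (suc i) ⊆ Z i) ×
  (∀ i → 1 ≤ i → i < L → ∀ u → u ∈ Z i →
     b ℚ.* d ℚ.< ℕtoℚ (degIn G (Z i) u) → u ∈ Z (suc i)) ×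
  (∀ i → 1 ≤ i → i < L → ∀ u → u ∈ Z i →
     ℕtoℚ (degIn G (Z i) u) ℚ.< d → u ∉ Z (suc i))

-- ℓ(u) = i, i.e. u ∈ V_i  (V_i = Z_i ∖ Z_{i+1} for i < L, V_L = Z_L)
IsLevel : ∀ {n} → ℕ → (ℕ → Subset n) → Fin n → ℕ → Set
IsLevel L Z u i = 1 ≤ i × i ≤ L × u ∈ Z i × (i < L → u ∉ Z (suc i))

IsOrientation : ∀ {n} → Graph n → ℕ → (ℕ → Subset n) → (Fin n → Fin n → Set) → Set
IsOrientation G L Z _≺_ =
  (∀ u v → T (adj G u v) → (u ≺ v) ⊎ (v ≺ u)) ×
  (∀ u v → T (adj G u v) → ¬ ((u ≺ v) × (v ≺ u))) ×
  (∀ u v → T (adj G u v) → ∀ i j → IsLevel L Z u i → IsLevel L Z v j → i < j → u ≺ v)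

-- Edge colorings: χ x y is the color of edge {x , y} (nothing = uncolored)

Coloring : ℕ → Set
Coloring n = Fin n → Fin n → Maybe ℕ

IsEdgeColoringFn : ∀ {n} → Graph n → Coloring n → Set
IsEdgeColoringFn G χ = (∀ x y → χ x y ≡ χ y x) × (∀ x y → adj G x y ≡ false → χ x y ≡ nothing)

Proper : ∀ {n} → Coloring n → Set
Proper χ = ∀ x y z c → y ≢ z → χ x y ≡ just c → χ x z ≢ just c

ColorsIn : ∀ {n} → ℚ → Coloring n → Set
ColorsIn q χ = ∀ x y c → χ x y ≡ just c → InPalette q c

IsProperColoringExcept : ∀ {n} → Graph n → Edge n → ℚ → Coloring n → Set
IsProperColoringExcept G e q χ =
  IsEdgeColoringFn G χ ×
  (∀ x y → T (adj G x y) → ¬ SameEdge (x , y) e → ∃ λ c → χ x y ≡ just c) ×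
  (χ (proj₁ e) (proj₂ e) ≡ nothing) ×
  Proper χ × ColorsIn q χ

IsProperColoring : ∀ {n} → Graph n → ℚ → Coloring n → Set
IsProperColoring G q χ =
  IsEdgeColoringFn G χ ×
  (∀ x y → T (adj G x y) → ∃ λ c → χ x y ≡ just c) ×
  Proper χ × ColorsIn q χ

upd : ∀ {n} → Coloring n → Fin n → Fin n → Maybe ℕ → Coloring n
upd χ a b m x y = if sameᵇ (x , y) (a , b) then m else χ x y

colorsAt : ∀ {n} → Graph n → Coloring n → Fin n → Subset n → List ℕ
colorsAt {n} G χ u S =
  deduplicate ℕ._≟_ (catMaybes (map (χ u) (filterᵇ (λ w → lookup S w ∧ adj G u w) (allFin n))))

-- The procedure ExtendColoring as a nondeterministic transition system.
-- A state is the current coloring χ and the current set S (as a list).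

State : ℕ → Set
State n = Coloring n × List (Edge n)

module Procedure {n : ℕ} (G : Graph n) (L : ℕ) (Z : ℕ → Subset n)
                 (_≺_ : Fin n → Fin n → Set) where

  -- one iteration of the while loop; the Edge index is the edge f that gets colored
  data Step : State n → Edge n → State n → Set where
    step-conflict : ∀ {χ xs ys a b u v i c w} →
      SameEdge (u , v) (a , b) → u ≺ v → IsLevel L Z u i →
      1 ≤ c → c ≤ length (colorsAt G χ u (Z i)) + length (colorsAt G χ v ⊤) + 1 →
      ¬ (c ∈ˡ colorsAt G χ u (Z i)) → ¬ (c ∈ˡ colorsAt G χ v ⊤) →
      T (adj G u w) → χ u w ≡ just c →
      Step (χ , xs ++ (a , b) ∷ ys) (u , v)
           (upd (upd χ u w nothing) u v (just c) , (u , w) ∷ xs ++ ys)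
    step-free : ∀ {χ xs ys a b u v i c} →
      SameEdge (u , v) (a , b) → u ≺ v → IsLevel L Z u i →
      1 ≤ c → c ≤ length (colorsAt G χ u (Z i)) + length (colorsAt G χ v ⊤) + 1 →
      ¬ (c ∈ˡ colorsAt G χ u (Z i)) → ¬ (c ∈ˡ colorsAt G χ v ⊤) →
      (∀ w → T (adj G u w) → χ u w ≢ just c) →
      Step (χ , xs ++ (a , b) ∷ ys) (u , v) (upd χ u v (just c) , xs ++ ys)

  data Run : State n → List (Edge n) → State n → Set where
    done : ∀ {s} → Run s [] s
    next : ∀ {s f s' fs s''} → Step s f s' → Run s' fs s'' → Run s (f ∷ fs) s''

  Successor : State n → State n → Set
  Successor s' s = ∃ λ f → Step s f s'

distinctEdges : ∀ {n} → Graph n → List (Edge n) → ℕ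
distinctEdges {n} G fs =
  length (filterᵇ (λ p → adj G (proj₁ p) (proj₂ p) ∧ any (sameᵇ p) fs) (upairs n))

-- Correctness of ExtendColoring(e, (Z_i)_i) started from χ:
--  * every execution terminates (no infinite sequence of iterations),
--  * the procedure never gets stuck while S ≠ ∅,
--  * every completed execution changes the colors of at most L edges and
--    ends with a proper edge coloring of G with colors in [q].
ExtendColoringCorrect : ∀ {n} → Graph n → ℕ → (ℕ → Subset n) →
  (Fin n → Fin n → Set) → ℚ → Edge n → Coloring n → Set
ExtendColoringCorrect {n} G L Z _≺_ q e χ =
  Acc Successor (χ , [ e ]) ×
  (∀ fs s → Run (χ , [ e ]) fs s → proj₂ s ≢ [] → ∃ λ f → ∃ λ s' → Step s f s') ×
  (∀ fs s → Run (χ , [ e ]) fs s → proj₂ s ≡ [] →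
     distinctEdges G fs ≤ L × IsProperColoring G q (proj₁ s))
  where open Procedure G L Z _≺_

-- Edges are oriented towards higher levels, and S never holds more than one edge. When the
-- pending edge u → v gets colour c, c is missing at v and on the edges of u inside G[Z ℓ(u)],
-- so the only edge that can lose its colour is an edge u w with w ∉ Z ℓ(u), i.e. of lower
-- level: the lower endpoint of the pending edge descends at least one level per iteration, so
-- there are at most L of them. The new colour is at most deg⁺(u) + Δ, and deg⁺(u) ≤ β d because
-- every level lies below L: by the arboricity bound on degree sums each Z (i + 1) is smaller
-- than Z i by a factor 1 + ε, so Z L is empty once (1 + ε) ^ k ≥ n.

module Submission where

open import Defs
open import Data.Nat using (ℕ; _+_)
open import Data.Rational using (ℚ; 0ℚ; 1ℚ; _<_)
open import Data.Rational as ℚ using ()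
open import Data.Fin using (Fin)
open import Data.Fin.Subset using (Subset)
open import Data.Bool using (T)
open import Data.Product using (_,_)

open import Data.Nat as ℕ using (zero; suc; pred; _*_; _∸_; _≤_; z≤n; s≤s; _<ᵇ_)
open import Data.Bool using (Bool; true; false; _∧_; if_then_else_)
open import Data.Bool.ListAction using (any)
open import Data.Bool.Properties using (T?; T-∧; T-≡; ∧-zeroʳ)
open import Data.Empty using (⊥-elim)
open import Data.Fin as Fin using (toℕ)
open import Data.Fin.Properties using (_≟_; any?; pigeonhole; ¬∀⟶∃¬; toℕ<n; toℕ-injective)
open import Data.Fin.Subset using (_∈_; _∉_; _⊆_; ⊤; ∣_∣)
open import Data.Fin.Subset.Properties using (∈⊤; ∣⊤∣≡n; x∈p⇒∣p-x∣<∣p∣; x∈p∧x≢y⇒x∈p-y)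
  renaming (_∈?_ to _∈ˢ?_)
open import Data.Integer as ℤ using (+≤+)
import Data.Integer.DivMod as ℤ
import Data.Integer.Properties as ℤ
open import Data.List as List
  using (List; []; _∷_; [_]; _++_; length; tabulate; allFin; map; filterᵇ; catMaybes;
         cartesianProduct)
open import Data.List.Membership.DecPropositional ℕ._≟_ using (_∈?_)
open import Data.List.Membership.Propositional using () renaming (_∈_ to _∈ˡ_; _∉_ to _∉ˡ_)
open import Data.List.Membership.Propositional.Properties
  using (∈-lookup; ∈-filter⁺; ∈-filter⁻; ∈-allFin; ∈-map⁺; ∈-++⁺ˡ; ∈-++⁺ʳ; ∈-deduplicate⁺)
open import Data.List.Properties
  using (length-tabulate; length-deduplicate; length-catMaybes; length-map; length-++; filter-++; map-tabulate)
open import Data.List.Relation.Unary.All as All using (_∷_)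
open import Data.List.Relation.Unary.AllPairs using (_∷_)
open import Data.List.Relation.Unary.Any as Any using (Any; here; there)
open import Data.List.Relation.Unary.Any.Properties using (lookup-index; any⁻)
open import Data.List.Relation.Unary.Unique.Propositional using (Unique)
open import Data.List.Relation.Unary.Unique.Propositional.Properties using (allFin⁺; filter⁺; cartesianProduct⁺)
open import Data.Maybe using (Maybe; just; nothing)
import Data.Maybe.Properties as Maybe
import Data.Nat.Coprimality as Coprime
open import Data.Nat.DivMod using (_/_; m*n/n≡m; /-monoˡ-≤)
open import Data.Nat.Induction using (<-rec)
open import Data.Nat.Properties
  using (module ≤-Reasoning; ≤-refl; ≤-reflexive; ≤-trans; ≤-antisym; ≤-<-trans; <-≤-trans; <-irrefl; <-asym;
         ≮⇒≥; ≰⇒>; 1+n≰n; n≤1+n; m≤m+n; m≤n+m; m<n⇒m<1+n; <⇒≤pred; m≤n⇒m<n∨m≡n; m∸n≤m; m∸n+n≡m;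
         ∸-monoˡ-≤; suc-injective; <ᵇ⇒<; <ᵇ-reflects-<; +-identityʳ; +-comm; +-assoc; +-suc; +-mono-≤;
         +-monoˡ-≤; *-assoc; *-monoˡ-≤; *-monoʳ-≤; +-0-commutativeMonoid)
open import Algebra.Properties.CommutativeMonoid.Sum +-0-commutativeMonoid
  using (sum-syntax; ∑-distrib-+; ∑-comm; sum-cong-≗; sum-replicate-zero)
open import Data.Product using (∃; ∃₂; _×_; proj₁; proj₂; map₂)
open import Data.Rational using (mkℚ; *≤*)
import Data.Rational.Properties as ℚ
open import Data.Rational.Solver using (module +-*-Solver)
open import Data.Sum using (_⊎_; inj₁; inj₂; [_,_]′)
open import Data.Vec using ([]; _∷_; lookup)
open import Data.Vec.Properties using ([]=⇒lookup; lookup⇒[]=; lookup-replicate)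
open import Function using (_∘_; flip; Equivalence)
open import Induction.WellFounded using (Acc; acc)
open import Relation.Binary.PropositionalEquality
  using (_≡_; _≢_; refl; sym; trans; cong; cong₂; subst; subst₂; module ≡-Reasoning)
open import Relation.Nullary using (¬_; Dec; yes; no; _×-dec_; _⊎-dec_)
open import Relation.Nullary.Decidable using (dec-true; dec-false)
open import Relation.Nullary.Reflects using (Reflects; ofʸ; ofⁿ)

private variable
  A B : Set

-- Edges and recolouring

module _ {n : ℕ} where

  sameEdge? : (e f : Edge n) → Dec (SameEdge e f)
  sameEdge? (x , y) (a , b) = ((x ≟ a) ×-dec (y ≟ b)) ⊎-dec ((x ≟ b) ×-dec (y ≟ a))

  T-sameᵇ : ∀ {e f : Edge n} → T (sameᵇ e f) → SameEdge e f
  T-sameᵇ {e} {f} = reflected (Dec.proof (sameEdge? e f))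
    where
    reflected : ∀ {b} → Reflects (SameEdge e f) b → T b → SameEdge e f
    reflected (ofʸ s) _ = s

  SameEdge-swapˡ : ∀ {x y : Fin n} {f} → SameEdge (x , y) f → SameEdge (y , x) f
  SameEdge-swapˡ (inj₁ (p , q)) = inj₂ (q , p)
  SameEdge-swapˡ (inj₂ (p , q)) = inj₁ (q , p)

  SameEdge-sym : ∀ {e f : Edge n} → SameEdge e f → SameEdge f e
  SameEdge-sym (inj₁ (refl , refl)) = inj₁ (refl , refl)
  SameEdge-sym (inj₂ (refl , refl)) = inj₂ (refl , refl)

  SameEdge-trans : ∀ {e f g : Edge n} → SameEdge e f → SameEdge f g → SameEdge e g
  SameEdge-trans (inj₁ (refl , refl)) s = s
  SameEdge-trans (inj₂ (refl , refl)) s = SameEdge-swapˡ s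

  SameEdge-refl : ∀ {e : Edge n} → SameEdge e e
  SameEdge-refl = inj₁ (refl , refl)

  upd-same : ∀ χ {a b} m {x y : Fin n} → SameEdge (x , y) (a , b) → upd χ a b m x y ≡ m
  upd-same χ m {x} {y} s = cong (if_then m else χ x y) (dec-true (sameEdge? _ _) s)

  upd-other : ∀ χ {a b} m {x y : Fin n} → ¬ SameEdge (x , y) (a , b) → upd χ a b m x y ≡ χ x y
  upd-other χ m {x} {y} ¬s = cong (if_then m else χ x y) (dec-false (sameEdge? _ _) ¬s)

  SameEdge-endpoint : ∀ {x y z : Fin n} {e} → SameEdge (x , y) e → SameEdge (x , z) e →
                      proj₁ e ≢ proj₂ e → y ≡ z
  SameEdge-endpoint (inj₁ (refl , refl)) (inj₁ (_ , refl)) _ = refl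
  SameEdge-endpoint (inj₁ (refl , refl)) (inj₂ (x≡b , _)) a≢b = ⊥-elim (a≢b x≡b)
  SameEdge-endpoint (inj₂ (refl , refl)) (inj₁ (x≡a , _)) a≢b = ⊥-elim (a≢b (sym x≡a))
  SameEdge-endpoint (inj₂ (refl , refl)) (inj₂ (_ , refl)) _ = refl

  module _ (G : Graph n) where

    adj-SameEdge : ∀ {x y a b} → SameEdge (x , y) (a , b) → adj G x y ≡ adj G a b
    adj-SameEdge (inj₁ (refl , refl)) = refl
    adj-SameEdge (inj₂ (refl , refl)) = adj-sym G _ _

    adj⇒≢ : ∀ {u v} → T (adj G u v) → u ≢ v
    adj⇒≢ {u} uv refl = subst T (adj-irr G u) uv

    colored⇒adj : ∀ {χ} → IsEdgeColoringFn G χ → ∀ {x y c} → χ x y ≡ just c → T (adj G x y)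
    colored⇒adj (_ , off) {x} {y} χxy with adj G x y in eq
    ... | true  = _
    ... | false with () ← trans (sym (off x y eq)) χxy

  Free : Coloring n → ℕ → Fin n → Set
  Free χ c x = ∀ z → χ x z ≢ just c

  SameEdge-Free : ∀ {χ c x y u v} → SameEdge (x , y) (u , v) → Free χ c u → Free χ c v → Free χ c x
  SameEdge-Free (inj₁ (refl , _)) free-u _ = free-u
  SameEdge-Free (inj₂ (refl , _)) _ free-v = free-v

  uncolor-just : ∀ χ {a b x y : Fin n} {c} → upd χ a b nothing x y ≡ just c → χ x y ≡ just c
  uncolor-just χ {a} {b} {x} {y} eq with sameEdge? (x , y) (a , b)
  ... | yes s with () ← trans (sym (upd-same χ nothing s)) eq
  ... | no ¬s = trans (sym (upd-other χ nothing ¬s)) eq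

  module _ (G : Graph n) (q : ℚ) where

    IsPartialColoring : Coloring n → Set
    IsPartialColoring χ = IsEdgeColoringFn G χ × Proper χ × ColorsIn q χ

    upd-IsEdgeColoringFn : ∀ {χ a b} m → IsEdgeColoringFn G χ → T (adj G a b) →
                           IsEdgeColoringFn G (upd χ a b m)
    upd-IsEdgeColoringFn {χ} {a} {b} m (sym-χ , off) ab = sym-χ′ , off′
      where
      sym-χ′ : ∀ x y → upd χ a b m x y ≡ upd χ a b m y x
      sym-χ′ x y with sameEdge? (x , y) (a , b)
      ... | yes s = trans (upd-same χ m s) (sym (upd-same χ m (SameEdge-swapˡ s)))
      ... | no ¬s = trans (upd-other χ m ¬s)
                      (trans (sym-χ x y) (sym (upd-other χ m (¬s ∘ SameEdge-swapˡ))))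
      off′ : ∀ x y → adj G x y ≡ false → upd χ a b m x y ≡ nothing
      off′ x y xy with sameEdge? (x , y) (a , b)
      ... | yes s = ⊥-elim (subst T (trans (sym (adj-SameEdge G s)) xy) ab)
      ... | no ¬s = trans (upd-other χ m ¬s) (off x y xy)

    uncolor-partial : ∀ {χ a b} → IsPartialColoring χ → T (adj G a b) →
                      IsPartialColoring (upd χ a b nothing)
    uncolor-partial {χ} (fn , proper , palette) ab =
      upd-IsEdgeColoringFn nothing fn ab ,
      (λ x y z c y≢z χxy χxz → proper x y z c y≢z (uncolor-just χ χxy) (uncolor-just χ χxz)) ,
      (λ x y c χxy → palette x y c (uncolor-just χ χxy))

    color-partial : ∀ {χ u v c} → IsPartialColoring χ → T (adj G u v) → InPalette q c →
                    Free χ c u → Free χ c v → IsPartialColoring (upd χ u v (just c))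
    color-partial {χ} {u} {v} {c} (fn , proper , palette) uv c∈q free-u free-v =
      upd-IsEdgeColoringFn (just c) fn uv , proper′ , palette′
      where
      χ′ = upd χ u v (just c)
      proper′ : Proper χ′
      proper′ x y z c′ y≢z χ′xy χ′xz with sameEdge? (x , y) (u , v) | sameEdge? (x , z) (u , v)
      ... | yes s | yes t = y≢z (SameEdge-endpoint s t (adj⇒≢ G uv))
      ... | yes s | no ¬t = SameEdge-Free s free-u free-v z
        (subst (λ d → χ x z ≡ just d) (Maybe.just-injective (trans (sym χ′xy) (upd-same χ (just c) s)))
               (trans (sym (upd-other χ (just c) ¬t)) χ′xz))
      ... | no ¬s | yes t = SameEdge-Free t free-u free-v y
        (subst (λ d → χ x y ≡ just d) (Maybe.just-injective (trans (sym χ′xz) (upd-same χ (just c) t)))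
               (trans (sym (upd-other χ (just c) ¬s)) χ′xy))
      ... | no ¬s | no ¬t = proper x y z c′ y≢z (trans (sym (upd-other χ (just c) ¬s)) χ′xy)
                                               (trans (sym (upd-other χ (just c) ¬t)) χ′xz)
      palette′ : ColorsIn q χ′
      palette′ x y c′ χ′xy with sameEdge? (x , y) (u , v)
      ... | yes s = subst (InPalette q) (Maybe.just-injective (trans (sym (upd-same χ (just c) s)) χ′xy)) c∈q
      ... | no ¬s = palette x y c′ (trans (sym (upd-other χ (just c) ¬s)) χ′xy)

    ProperExcept-SameEdge : ∀ {χ e f} → SameEdge e f → IsProperColoringExcept G e q χ →
                            IsProperColoringExcept G f q χ
    ProperExcept-SameEdge {χ} {x , y} {a , b} s (fn , covered , uncolored , rest) =
      fn , (λ u v uv ¬f → covered u v uv (¬f ∘ flip SameEdge-trans s)) , uncolored′ s , rest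
      where
      uncolored′ : SameEdge (x , y) (a , b) → χ a b ≡ nothing
      uncolored′ (inj₁ (refl , refl)) = uncolored
      uncolored′ (inj₂ (refl , refl)) = trans (proj₁ fn _ _) uncolored

    recolor-free : ∀ {χ u v c} → IsProperColoringExcept G (u , v) q χ → T (adj G u v) →
                   InPalette q c → Free χ c u → Free χ c v →
                   IsProperColoring G q (upd χ u v (just c))
    recolor-free {χ} {u} {v} {c} (fn , covered , _ , proper , palette) uv c∈q free-u free-v =
      proj₁ partial , covered′ , proj₂ partial
      where
      partial = color-partial (fn , proper , palette) uv c∈q free-u free-v
      covered′ : ∀ x y → T (adj G x y) → ∃ λ c′ → upd χ u v (just c) x y ≡ just c′
      covered′ x y xy with sameEdge? (x , y) (u , v)
      ... | yes s = c , upd-same χ (just c) s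
      ... | no ¬s = map₂ (trans (upd-other χ (just c) ¬s)) (covered x y xy ¬s)

    recolor-shift : ∀ {χ u v w c} → IsProperColoringExcept G (u , v) q χ → T (adj G u v) →
                    InPalette q c → Free χ c v → χ u w ≡ just c →
                    IsProperColoringExcept G (u , w) q (upd (upd χ u w nothing) u v (just c))
    recolor-shift {χ} {u} {v} {w} {c} (fn , covered , uncolored , proper , palette) uv c∈q free-v χuw =
      proj₁ partial , covered′ , uncolored′ , proj₂ partial
      where
      uw = colored⇒adj G fn χuw
      χ₀ = upd χ u w nothing
      free₀-u : Free χ₀ c u
      free₀-u z χ₀uz with w ≟ z
      ... | yes refl with () ← trans (sym (upd-same χ nothing SameEdge-refl)) χ₀uz
      ... | no w≢z = proper u z w c (w≢z ∘ sym) (uncolor-just χ χ₀uz) χuw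
      partial = color-partial (uncolor-partial (fn , proper , palette) uw) uv c∈q
                              free₀-u (λ z → free-v z ∘ uncolor-just χ)
      uw≠uv : ¬ SameEdge (u , w) (u , v)
      uw≠uv (inj₁ (_ , refl)) with () ← trans (sym uncolored) χuw
      uw≠uv (inj₂ (u≡v , _)) = adj⇒≢ G uv u≡v
      covered′ : ∀ x y → T (adj G x y) → ¬ SameEdge (x , y) (u , w) →
                 ∃ λ c′ → upd χ₀ u v (just c) x y ≡ just c′
      covered′ x y xy ¬uw with sameEdge? (x , y) (u , v)
      ... | yes s = c , upd-same χ₀ (just c) s
      ... | no ¬s = map₂ (trans (trans (upd-other χ₀ (just c) ¬s) (upd-other χ nothing ¬uw)))
                         (covered x y xy ¬s)
      uncolored′ : upd χ₀ u v (just c) u w ≡ nothing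
      uncolored′ = trans (upd-other χ₀ (just c) uw≠uv) (upd-same χ nothing SameEdge-refl)

-- Counting: pigeonhole, fresh colours, repeated edges

lookup-Unique : ∀ {xs : List A} → Unique xs → ∀ {i j} → i Fin.< j → List.lookup xs i ≢ List.lookup xs j
lookup-Unique (x≢xs ∷ _)  {Fin.zero}  {Fin.suc j} _         = All.lookup x≢xs (∈-lookup j)
lookup-Unique (_ ∷ unique) {Fin.suc i} {Fin.suc j} (s≤s i<j) = lookup-Unique unique i<j

Unique-length-≤ : ∀ {R : A → B → Set} {xs : List A} {ys : List B} → Unique xs →
                  (∀ {x} → x ∈ˡ xs → Any (R x) ys) →
                  (∀ {x x′ y} → x ∈ˡ xs → x′ ∈ˡ xs → R x y → R x′ y → x ≡ x′) →
                  length xs ≤ length ys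
Unique-length-≤ {R = R} {xs} {ys} unique cover injective = ≮⇒≥ λ ys<xs →
  let i , j , i<j , same = pigeonhole ys<xs position
  in lookup-Unique unique i<j
       (injective (∈-lookup i) (∈-lookup j) (lookup-index (cover (∈-lookup i)))
                  (subst (R (List.lookup xs j) ∘ List.lookup ys) (sym same)
                         (lookup-index (cover (∈-lookup j)))))
  where
  position : Fin (length xs) → Fin (length ys)
  position i = Any.index (cover (∈-lookup i))

fresh-color : (l : List ℕ) → ∃ λ c → 1 ≤ c × c ≤ suc (length l) × c ∉ˡ l
fresh-color l with ¬∀⟶∃¬ (suc (length l)) (λ i → suc (toℕ i) ∈ˡ l) (λ i → suc (toℕ i) ∈? l) all-taken
  where
  all-taken : ¬ (∀ (i : Fin (suc (length l))) → suc (toℕ i) ∈ˡ l)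
  all-taken taken = 1+n≰n (subst (_≤ length l) (length-tabulate (λ i → i))
    (Unique-length-≤ (allFin⁺ _) (λ {i} _ → taken i)
                     (λ _ _ p q → toℕ-injective (suc-injective (trans p (sym q))))))
... | i , i∉l = suc (toℕ i) , s≤s z≤n , toℕ<n i , i∉l

fresh-color₂ : (l₁ l₂ : List ℕ) → ∃ λ c → 1 ≤ c × c ≤ length l₁ + length l₂ + 1 × c ∉ˡ l₁ × c ∉ˡ l₂
fresh-color₂ l₁ l₂ with fresh-color (l₁ ++ l₂)
... | c , 1≤c , c≤ , c∉ = c , 1≤c ,
  subst (c ≤_) (trans (cong suc (length-++ l₁)) (+-comm 1 _)) c≤ ,
  c∉ ∘ ∈-++⁺ˡ , c∉ ∘ ∈-++⁺ʳ l₁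

∈-catMaybes⁺ : ∀ {x : A} {xs} → just x ∈ˡ xs → x ∈ˡ catMaybes xs
∈-catMaybes⁺ {xs = just _ ∷ _}  (here refl) = here refl
∈-catMaybes⁺ {xs = just _ ∷ _}  (there p)   = there (∈-catMaybes⁺ p)
∈-catMaybes⁺ {xs = nothing ∷ _} (there p)   = ∈-catMaybes⁺ p

length-catMaybes-< : ∀ {xs : List (Maybe A)} → nothing ∈ˡ xs → length (catMaybes xs) ℕ.< length xs
length-catMaybes-< {xs = _ ∷ xs} (here refl) = s≤s (length-catMaybes xs)
length-catMaybes-< {xs = just _ ∷ _}  (there p) = s≤s (length-catMaybes-< p)
length-catMaybes-< {xs = nothing ∷ _} (there p) = m<n⇒m<1+n (length-catMaybes-< p)

module _ {n : ℕ} (G : Graph n) where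

  neighbours : Subset n → Fin n → List (Fin n)
  neighbours S u = filterᵇ (λ w → lookup S w ∧ adj G u w) (allFin n)

  ∈-neighbours : ∀ {S u w} → w ∈ S → T (adj G u w) → w ∈ˡ neighbours S u
  ∈-neighbours {S} w∈S uw = ∈-filter⁺ (T? ∘ _) (∈-allFin _)
    (Equivalence.from T-∧ (subst T (sym ([]=⇒lookup w∈S)) _ , uw))

  module _ (χ : Coloring n) where

    ∈-map-χ : ∀ {S u w c} → w ∈ S → T (adj G u w) → χ u w ≡ c → c ∈ˡ map (χ u) (neighbours S u)
    ∈-map-χ {S} {u} w∈S uw χuw = subst (_∈ˡ map (χ u) (neighbours S u)) χuw
                                          (∈-map⁺ (χ u) (∈-neighbours w∈S uw))

    ∈-colorsAt : ∀ {S u w c} → w ∈ S → T (adj G u w) → χ u w ≡ just c → c ∈ˡ colorsAt G χ u S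
    ∈-colorsAt w∈S uw χuw = ∈-deduplicate⁺ ℕ._≟_ (∈-catMaybes⁺ (∈-map-χ w∈S uw χuw))

    length-colorsAt : ∀ S u → length (colorsAt G χ u S) ≤ degIn G S u
    length-colorsAt S u = ≤-trans (length-deduplicate ℕ._≟_ (catMaybes (map (χ u) (neighbours S u))))
      (≤-trans (length-catMaybes (map (χ u) (neighbours S u)))
               (≤-reflexive (length-map (χ u) (neighbours S u))))

    length-colorsAt-< : ∀ {S u w} → w ∈ S → T (adj G u w) → χ u w ≡ nothing →
                        length (colorsAt G χ u S) ℕ.< degIn G S u
    length-colorsAt-< {S} {u} w∈S uw χuw =
      ≤-<-trans (length-deduplicate ℕ._≟_ (catMaybes (map (χ u) (neighbours S u))))
        (<-≤-trans (length-catMaybes-< (∈-map-χ w∈S uw χuw))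
                   (≤-reflexive (length-map (χ u) (neighbours S u))))

  ordered-SameEdge : ∀ {x y : Edge n} → toℕ (proj₁ x) ℕ.< toℕ (proj₂ x) →
                     toℕ (proj₁ y) ℕ.< toℕ (proj₂ y) → SameEdge x y → x ≡ y
  ordered-SameEdge _ _ (inj₁ (refl , refl)) = refl
  ordered-SameEdge x< y< (inj₂ (refl , refl)) = ⊥-elim (<-asym x< y<)

  distinctEdges-≤ : ∀ fs → distinctEdges G fs ≤ length fs
  distinctEdges-≤ fs = Unique-length-≤ {R = SameEdge} unique cover
    (λ m m′ s s′ → ordered-SameEdge (ordered m) (ordered m′) (SameEdge-trans s (SameEdge-sym s′)))
    where
    ordered? distinct? : Edge n → Bool
    ordered? (x , y) = toℕ x <ᵇ toℕ y
    distinct? (x , y) = adj G x y ∧ any (sameᵇ (x , y)) fs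
    unique : Unique (filterᵇ distinct? (upairs n))
    unique = filter⁺ (T? ∘ distinct?) (filter⁺ (T? ∘ ordered?) (cartesianProduct⁺ (allFin⁺ n) (allFin⁺ n)))
    ordered : ∀ {x} → x ∈ˡ filterᵇ distinct? (upairs n) → toℕ (proj₁ x) ℕ.< toℕ (proj₂ x)
    ordered m = <ᵇ⇒< _ _ (proj₂ (∈-filter⁻ (T? ∘ ordered?) {xs = cartesianProduct (allFin n) (allFin n)}
                                 (proj₁ (∈-filter⁻ (T? ∘ distinct?) {xs = upairs n} m))))
    cover : ∀ {x} → x ∈ˡ filterᵇ distinct? (upairs n) → Any (SameEdge x) fs
    cover {x} m = Any.map T-sameᵇ (any⁻ (sameᵇ x) fs
      (proj₂ (Equivalence.to T-∧ (proj₂ (∈-filter⁻ (T? ∘ distinct?) {xs = upairs n} m)))))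

  degIn-pos : ∀ {S u w} → w ∈ S → T (adj G u w) → 1 ≤ degIn G S u
  degIn-pos w∈S uw = nonempty (∈-neighbours w∈S uw)
    where
    nonempty : ∀ {x : Fin n} {xs} → x ∈ˡ xs → 1 ≤ length xs
    nonempty (here _)  = s≤s z≤n
    nonempty (there _) = s≤s z≤n

-- Degree sums and arboricity

𝟙 : Bool → ℕ
𝟙 b = if b then 1 else 0

filterᵇ-∧ : ∀ (p q : A → Bool) xs → filterᵇ q (filterᵇ p xs) ≡ filterᵇ (λ x → p x ∧ q x) xs
filterᵇ-∧ p q [] = refl
filterᵇ-∧ p q (x ∷ xs) with p x
... | false = filterᵇ-∧ p q xs
... | true with q x
...   | true  = cong (x ∷_) (filterᵇ-∧ p q xs)
...   | false = filterᵇ-∧ p q xs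

length-filterᵇ-tabulate : ∀ {n} (p : A → Bool) (f : Fin n → A) →
                          length (filterᵇ p (tabulate f)) ≡ ∑[ i < n ] 𝟙 (p (f i))
length-filterᵇ-tabulate {n = zero}  p f = refl
length-filterᵇ-tabulate {n = suc n} p f with p (f Fin.zero)
... | true  = cong suc (length-filterᵇ-tabulate p (f ∘ Fin.suc))
... | false = length-filterᵇ-tabulate p (f ∘ Fin.suc)

length-filterᵇ-cartesianProduct :
  ∀ {m n} (p : A × B → Bool) (f : Fin m → A) (g : Fin n → B) →
  length (filterᵇ p (cartesianProduct (tabulate f) (tabulate g))) ≡ ∑[ i < m ] ∑[ j < n ] 𝟙 (p (f i , g j))
length-filterᵇ-cartesianProduct {m = zero}  p f g = refl
length-filterᵇ-cartesianProduct {m = suc m} {n} p f g = begin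
  length (filterᵇ p (row ++ rest))                 ≡⟨ cong length (filter-++ (T? ∘ p) row rest) ⟩
  length (filterᵇ p row ++ filterᵇ p rest)         ≡⟨ length-++ (filterᵇ p row) ⟩
  length (filterᵇ p row) + length (filterᵇ p rest) ≡⟨ cong₂ _+_ first-row
                                                        (length-filterᵇ-cartesianProduct p (f ∘ Fin.suc) g) ⟩
  ∑[ j < n ] 𝟙 (p (f Fin.zero , g j)) + ∑[ i < m ] ∑[ j < n ] 𝟙 (p (f (Fin.suc i) , g j)) ∎
  where
  row  = map (f Fin.zero ,_) (tabulate g)
  rest = cartesianProduct (tabulate (f ∘ Fin.suc)) (tabulate g)
  open ≡-Reasoning
  first-row = trans (cong (length ∘ filterᵇ p) (map-tabulate g (f Fin.zero ,_)))
                    (length-filterᵇ-tabulate p ((f Fin.zero ,_) ∘ g))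

∑-mono-≤ : ∀ {n} {f g : Fin n → ℕ} → (∀ i → f i ≤ g i) → ∑[ i < n ] f i ≤ ∑[ i < n ] g i
∑-mono-≤ {zero}  _   = z≤n
∑-mono-≤ {suc n} f≤g = +-mono-≤ (f≤g Fin.zero) (∑-mono-≤ (f≤g ∘ Fin.suc))

∑-≥-term : ∀ {n} (f : Fin n → ℕ) i → f i ≤ ∑[ j < n ] f j
∑-≥-term f Fin.zero    = m≤m+n _ _
∑-≥-term f (Fin.suc i) = ≤-trans (∑-≥-term (f ∘ Fin.suc) i) (m≤n+m _ _)

∣∣≡∑ : ∀ {n} (S : Subset n) → ∣ S ∣ ≡ ∑[ x < n ] 𝟙 (lookup S x)
∣∣≡∑ []           = refl
∣∣≡∑ (true ∷ S)  = cong suc (∣∣≡∑ S)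
∣∣≡∑ (false ∷ S) = ∣∣≡∑ S

𝟙-split : ∀ m n b → (m ≡ n → b ≡ false) → 𝟙 b ≡ 𝟙 ((m <ᵇ n) ∧ b) + 𝟙 ((n <ᵇ m) ∧ b)
𝟙-split m n b diagonal with m <ᵇ n | <ᵇ-reflects-< m n | n <ᵇ m | <ᵇ-reflects-< n m
... | true  | ofʸ m<n | true  | ofʸ n<m = ⊥-elim (<-asym m<n n<m)
... | true  | _       | false | _       = sym (+-identityʳ (𝟙 b))
... | false | _       | true  | _       = refl
... | false | ofⁿ m≮n | false | ofⁿ n≮m rewrite diagonal (≤-antisym (≮⇒≥ n≮m) (≮⇒≥ m≮n)) = refl

ceilDiv-≤⇒≤* : ∀ m k a → 1 ≤ k → ceilDiv m k ≤ a → m ≤ a * k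
ceilDiv-≤⇒≤* m (suc k) a _ ⌈m/k+1⌉≤a = ≮⇒≥ λ a[k+1]<m → 1+n≰n (begin
  suc a                   ≡⟨ m*n/n≡m (suc a) (suc k) ⟨
  suc a * suc k / suc k   ≤⟨ /-monoˡ-≤ (suc k) (≤-trans (≤-reflexive (cong suc (+-comm k (a * suc k))))
                                                       (+-monoˡ-≤ k a[k+1]<m)) ⟩
  (m + k) / suc k         ≤⟨ ⌈m/k+1⌉≤a ⟩
  a                       ∎)
  where open ≤-Reasoning

∣∣≥2 : ∀ {n} {S : Subset n} {x y} → x ∈ S → y ∈ S → x ≢ y → 2 ≤ ∣ S ∣
∣∣≥2 x∈S y∈S x≢y =
  ≤-trans (s≤s (≤-trans (s≤s z≤n) (x∈p⇒∣p-x∣<∣p∣ (x∈p∧x≢y⇒x∈p-y y∈S (x≢y ∘ sym)))))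
          (x∈p⇒∣p-x∣<∣p∣ x∈S)

T-lookup⇒∈ : ∀ {n} {S : Subset n} {x} → T (lookup S x) → x ∈ S
T-lookup⇒∈ {S = S} {x} t = lookup⇒[]= x S (Equivalence.to T-≡ t)

module _ {n : ℕ} (G : Graph n) where

  adjIn : Subset n → Fin n → Fin n → Bool
  adjIn S x y = lookup S x ∧ lookup S y ∧ adj G x y

  adjIn-sym : ∀ S x y → adjIn S x y ≡ adjIn S y x
  adjIn-sym S x y with lookup S x | lookup S y
  ... | true  | true  = adj-sym G x y
  ... | true  | false = refl
  ... | false | true  = refl
  ... | false | false = refl

  adjIn-irr : ∀ S x → adjIn S x x ≡ false
  adjIn-irr S x rewrite adj-irr G x | ∧-zeroʳ (lookup S x) = ∧-zeroʳ (lookup S x)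

  degIn≡∑ : ∀ S u → degIn G S u ≡ ∑[ w < n ] 𝟙 (lookup S w ∧ adj G u w)
  degIn≡∑ S u = length-filterᵇ-tabulate (λ w → lookup S w ∧ adj G u w) (λ w → w)

  edgesIn≡∑ : ∀ S → length (edgesIn G S) ≡ ∑[ x < n ] ∑[ y < n ] 𝟙 ((toℕ x <ᵇ toℕ y) ∧ adjIn S x y)
  edgesIn≡∑ S = trans (cong length (filterᵇ-∧ _ _ (cartesianProduct (allFin n) (allFin n))))
                      (length-filterᵇ-cartesianProduct
                        (λ (x , y) → (toℕ x <ᵇ toℕ y) ∧ adjIn S x y) (λ x → x) (λ y → y))

  degreeSum : Subset n → Subset n → ℕ
  degreeSum U S = ∑[ x < n ] (if lookup U x then degIn G S x else 0)

  handshake : ∀ S → degreeSum S S ≡ length (edgesIn G S) + length (edgesIn G S)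
  handshake S = begin
    degreeSum S S                                    ≡⟨ sum-cong-≗ row ⟩
    ∑[ x < n ] ∑[ y < n ] 𝟙 (adjIn S x y)           ≡⟨ sum-cong-≗ (λ x → sum-cong-≗ (split x)) ⟩
    ∑[ x < n ] ∑[ y < n ] (h x y + h y x)            ≡⟨ sum-cong-≗ (λ x → ∑-distrib-+ (h x) (λ y → h y x)) ⟩
    ∑[ x < n ] (∑[ y < n ] h x y + ∑[ y < n ] h y x) ≡⟨ ∑-distrib-+ (λ x → ∑[ y < n ] h x y) _ ⟩
    E + ∑[ x < n ] ∑[ y < n ] h y x                  ≡⟨ cong (E +_) (∑-comm (λ x y → h y x)) ⟩
    E + E                                            ≡⟨ cong₂ _+_ (edgesIn≡∑ S) (edgesIn≡∑ S) ⟨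
    length (edgesIn G S) + length (edgesIn G S)      ∎
    where
    open ≡-Reasoning
    h : Fin n → Fin n → ℕ
    h x y = 𝟙 ((toℕ x <ᵇ toℕ y) ∧ adjIn S x y)
    E = ∑[ x < n ] ∑[ y < n ] h x y
    row : ∀ x → (if lookup S x then degIn G S x else 0) ≡ ∑[ y < n ] 𝟙 (adjIn S x y)
    row x with lookup S x
    ... | true  = degIn≡∑ S x
    ... | false = sym (sum-replicate-zero n)
    split : ∀ x y → 𝟙 (adjIn S x y) ≡ h x y + h y x
    split x y = trans (𝟙-split (toℕ x) (toℕ y) _ λ x≡y →
                         subst (λ z → adjIn S x z ≡ false) (toℕ-injective x≡y) (adjIn-irr S x))
                      (cong (λ b → h x y + 𝟙 ((toℕ y <ᵇ toℕ x) ∧ b)) (adjIn-sym S x y))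

  degreeSum-⊆ : ∀ {U S} → U ⊆ S → degreeSum U S ≤ degreeSum S S
  degreeSum-⊆ {U} {S} U⊆S = ∑-mono-≤ term
    where
    term : ∀ x → (if lookup U x then degIn G S x else 0) ≤ (if lookup S x then degIn G S x else 0)
    term x with lookup U x in x∈U
    ... | false = z≤n
    ... | true rewrite []=⇒lookup (U⊆S (lookup⇒[]= x U x∈U)) = ≤-refl

  T-adjIn : ∀ {S x y} → T (adjIn S x y) → x ∈ S × y ∈ S × T (adj G x y)
  T-adjIn {S} {x} {y} t =
    let Sx , Sy&xy = Equivalence.to (T-∧ {lookup S x}) t
        Sy , xy    = Equivalence.to (T-∧ {lookup S y}) Sy&xy
    in T-lookup⇒∈ Sx , T-lookup⇒∈ Sy , xy

  edgesIn-≤ : ∀ {a} → ArbBound G a → ∀ S → length (edgesIn G S) ≤ a * (∣ S ∣ ∸ 1)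
  edgesIn-≤ {a} arb S with edgesIn G S in eq
  ... | []    = z≤n
  ... | e ∷ _ = subst (_≤ a * (∣ S ∣ ∸ 1)) (cong length eq)
                      (ceilDiv-≤⇒≤* _ _ a (∸-monoˡ-≤ 1 two) (arb S two))
    where
    two : 2 ≤ ∣ S ∣
    two with x∈S , y∈S , xy ← T-adjIn {S} (proj₂ (∈-filter⁻ (T? ∘ λ (x , y) → adjIn S x y) {xs = upairs n}
                                                (subst (e ∈ˡ_) (sym eq) (here refl))))
      = ∣∣≥2 x∈S y∈S (adj⇒≢ G xy)

  degreeSum-≤ : ∀ {a} → ArbBound G a → ∀ {U S} → U ⊆ S → degreeSum U S ≤ 2 * (a * (∣ S ∣ ∸ 1))
  degreeSum-≤ arb {U} {S} U⊆S = ≤-trans (degreeSum-⊆ U⊆S) (≤-trans (≤-reflexive (handshake S))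
    (+-mono-≤ (edgesIn-≤ arb S) (≤-trans (edgesIn-≤ arb S) (≤-reflexive (sym (+-identityʳ _))))))

  arboricity-pos : ∀ {a} → ArbBound G a → ∀ {x y} → T (adj G x y) → 1 ≤ a
  arboricity-pos {suc _} _   _  = s≤s z≤n
  arboricity-pos {zero}  arb {x} xy = ⊥-elim (1+n≰n (begin
    1                                       ≤⟨ degIn-pos G ∈⊤ xy ⟩
    degIn G ⊤ x                             ≡⟨ cong (if_then degIn G ⊤ x else 0) (lookup-replicate x true) ⟨
    (if lookup ⊤ x then degIn G ⊤ x else 0) ≤⟨ ∑-≥-term (λ z → if lookup ⊤ z then degIn G ⊤ z else 0) x ⟩
    degreeSum ⊤ ⊤                           ≤⟨ degreeSum-≤ arb {⊤} {⊤} (λ z∈⊤ → z∈⊤) ⟩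
    0                                       ∎))
    where open ≤-Reasoning

-- Levels of a decomposition

module Levels {n : ℕ} (L : ℕ) (Z : ℕ → Subset n) (1≤L : 1 ≤ L) (Z₁≡⊤ : Z 1 ≡ ⊤)
              (Z-antitone : ∀ i → 1 ≤ i → i ℕ.< L → Z (suc i) ⊆ Z i) where

  Z-⊆ : ∀ {i j} → 1 ≤ i → i ≤ j → j ≤ L → Z j ⊆ Z i
  Z-⊆ 1≤i i≤j j≤L with m≤n⇒m<n∨m≡n i≤j
  ... | inj₂ refl = λ x∈ → x∈
  ... | inj₁ (s≤s i≤j′) = Z-⊆ 1≤i i≤j′ (≤-trans (n≤1+n _) j≤L) ∘ Z-antitone _ (≤-trans 1≤i i≤j′) j≤L

  level : ∀ u → ∃ (IsLevel L Z u)
  level u = climb (L ∸ 1) 1 ≤-refl (subst (u ∈_) (sym Z₁≡⊤) ∈⊤) (m∸n+n≡m 1≤L)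
    where
    climb : ∀ f i → 1 ≤ i → u ∈ Z i → f + i ≡ L → ∃ (IsLevel L Z u)
    climb zero    i 1≤i u∈Zᵢ refl = i , 1≤i , ≤-refl , u∈Zᵢ , λ i<i → ⊥-elim (<-irrefl refl i<i)
    climb (suc f) i 1≤i u∈Zᵢ f+i≡L with u ∈ˢ? Z (suc i)
    ... | yes u∈Zᵢ₊₁ = climb f (suc i) (s≤s z≤n) u∈Zᵢ₊₁ (trans (+-suc f i) f+i≡L)
    ... | no  u∉Zᵢ₊₁ = i , 1≤i , subst (i ≤_) f+i≡L (m≤n+m i (suc f)) , u∈Zᵢ , λ _ → u∉Zᵢ₊₁

  level-<-of-∉ : ∀ {u w i k} → IsLevel L Z u i → IsLevel L Z w k → w ∉ Z i → k ℕ.< i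
  level-<-of-∉ (1≤i , _) (_ , k≤L , w∈Zₖ , _) w∉Zᵢ = ≰⇒> (λ i≤k → w∉Zᵢ (Z-⊆ 1≤i i≤k k≤L w∈Zₖ))

-- ExtendColoring succeeds with any palette containing [deg⁺ u + Δ] for every vertex u

++-∷≢[] : ∀ (xs : List A) {y ys} → xs ++ y ∷ ys ≢ []
++-∷≢[] []      ()
++-∷≢[] (_ ∷ _) ()

++-∷≡-singleton : ∀ (xs ys : List A) {y z} → xs ++ y ∷ ys ≡ [ z ] → xs ≡ [] × y ≡ z × ys ≡ []
++-∷≡-singleton []          []      refl = refl , refl , refl
++-∷≡-singleton (_ ∷ [])     _      ()
++-∷≡-singleton (_ ∷ _ ∷ _)  _      ()

module Correctness {n : ℕ} (G : Graph n) (L : ℕ) (Z : ℕ → Subset n) (_≺_ : Fin n → Fin n → Set)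
  (Q : ℚ) (Δ : ℕ) (orientation : IsOrientation G L Z _≺_)
  (1≤L : 1 ≤ L) (Z₁≡⊤ : Z 1 ≡ ⊤) (Z-antitone : ∀ i → 1 ≤ i → i ℕ.< L → Z (suc i) ⊆ Z i)
  (max-degree : MaxDegreeAtMost G Δ)
  (palette : ∀ {u i} → IsLevel L Z u i → ∀ {c} → 1 ≤ c → c ≤ degIn G (Z i) u + Δ → InPalette Q c)
  where

  open Procedure G L Z _≺_
  open Levels L Z 1≤L Z₁≡⊤ Z-antitone

  EndpointBelow : ℕ → Fin n → Fin n → Set
  EndpointBelow m p q = ∀ {i j} → IsLevel L Z p i → IsLevel L Z q j → i ≤ m ⊎ j ≤ m

  data Invariant (m : ℕ) : State n → Set where
    finished : ∀ {χ S} → S ≡ [] → IsProperColoring G Q χ → Invariant m (χ , S)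
    pending  : ∀ {χ S p q} → S ≡ [ (p , q) ] → T (adj G p q) → IsProperColoringExcept G (p , q) Q χ →
               EndpointBelow m p q → Invariant m (χ , S)

  oriented : ∀ {p q} → T (adj G p q) → ∃₂ λ u v → SameEdge (u , v) (p , q) × u ≺ v
  oriented pq with proj₁ orientation _ _ pq
  ... | inj₁ p≺q = _ , _ , inj₁ (refl , refl) , p≺q
  ... | inj₂ q≺p = _ , _ , inj₂ (refl , refl) , q≺p

  oriented-level-≤ : ∀ {u v i j} → u ≺ v → T (adj G u v) → IsLevel L Z u i → IsLevel L Z v j → i ≤ j
  oriented-level-≤ {u} {v} u≺v uv ℓᵤ ℓᵥ = ≮⇒≥ λ j<i →
    proj₁ (proj₂ orientation) u v uv
      (u≺v , proj₂ (proj₂ orientation) v u (subst T (adj-sym G u v) uv) _ _ ℓᵥ ℓᵤ j<i)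

  tail-level-≤ : ∀ {m p q u v i} → EndpointBelow m p q → SameEdge (u , v) (p , q) → u ≺ v →
                 T (adj G u v) → IsLevel L Z u i → i ≤ m
  tail-level-≤ {v = v} below se u≺v uv ℓᵤ with j , ℓᵥ ← level v | se
  ... | inj₁ (refl , refl) = [ (λ i≤m → i≤m) , ≤-trans (oriented-level-≤ u≺v uv ℓᵤ ℓᵥ) ]′ (below ℓᵤ ℓᵥ)
  ... | inj₂ (refl , refl) = [ ≤-trans (oriented-level-≤ u≺v uv ℓᵤ ℓᵥ) , (λ i≤m → i≤m) ]′ (below ℓᵥ ℓᵤ)

  Free-of-∉ : ∀ {χ c v} → IsEdgeColoringFn G χ → c ∉ˡ colorsAt G χ v ⊤ → Free χ c v
  Free-of-∉ {χ} fn c∉Cᵥ z χvz = c∉Cᵥ (∈-colorsAt G χ ∈⊤ (colored⇒adj G fn χvz) χvz)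

  fresh-in-palette : ∀ {χ u v i c} → IsLevel L Z u i → IsEdgeColoringFn G χ → T (adj G u v) →
                     χ u v ≡ nothing → 1 ≤ c →
                     c ≤ length (colorsAt G χ u (Z i)) + length (colorsAt G χ v ⊤) + 1 → InPalette Q c
  fresh-in-palette {χ} {u} {v} {i} ℓᵤ (sym-χ , _) uv χuv 1≤c c≤ = palette ℓᵤ 1≤c (≤-trans c≤ (begin
    length Cᵤ + length Cᵥ + 1      ≡⟨ trans (+-assoc (length Cᵤ) _ 1)
                                            (cong (length Cᵤ +_) (+-comm (length Cᵥ) 1)) ⟩
    length Cᵤ + suc (length Cᵥ)    ≤⟨ +-mono-≤ (length-colorsAt G χ (Z i) u)
                                               (≤-trans (length-colorsAt-< G χ ∈⊤ vu (trans (sym-χ v u) χuv))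
                                                        (max-degree v)) ⟩
    degIn G (Z i) u + Δ            ∎))
    where
    open ≤-Reasoning
    Cᵤ = colorsAt G χ u (Z i)
    Cᵥ = colorsAt G χ v ⊤
    vu = subst T (adj-sym G u v) uv

  record Selected (m : ℕ) (χ : Coloring n) (u v : Fin n) (i c : ℕ) : Set where
    field
      adjacent   : T (adj G u v)
      except     : IsProperColoringExcept G (u , v) Q χ
      in-palette : InPalette Q c
      free-head  : Free χ c v
      level≤     : i ≤ m

  selected : ∀ {m χ p q u v i c} → T (adj G p q) → IsProperColoringExcept G (p , q) Q χ →
             EndpointBelow m p q → SameEdge (u , v) (p , q) → u ≺ v → IsLevel L Z u i → 1 ≤ c →
             c ≤ length (colorsAt G χ u (Z i)) + length (colorsAt G χ v ⊤) + 1 →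
             c ∉ˡ colorsAt G χ v ⊤ → Selected m χ u v i c
  selected pq pce below se u≺v ℓᵤ 1≤c c≤ c∉Cᵥ = record
    { adjacent   = uv
    ; except     = except
    ; in-palette = fresh-in-palette ℓᵤ (proj₁ except) uv (proj₁ (proj₂ (proj₂ except))) 1≤c c≤
    ; free-head  = Free-of-∉ (proj₁ except) c∉Cᵥ
    ; level≤     = tail-level-≤ below se u≺v uv ℓᵤ
    }
    where
    uv = subst T (sym (adj-SameEdge G se)) pq
    except = ProperExcept-SameEdge G Q (SameEdge-sym se) pce

  pred-< : ∀ {i m} → 1 ≤ i → i ≤ m → pred i ℕ.< m
  pred-< (s≤s z≤n) i≤m = i≤m

  step-invariant : ∀ {m s f s′} → Invariant m s → Step s f s′ → ∃ λ m′ → m′ ℕ.< m × Invariant m′ s′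
  step-invariant (finished S≡[] _) (step-conflict {xs = xs} _ _ _ _ _ _ _ _ _) =
    ⊥-elim (++-∷≢[] xs S≡[])
  step-invariant (finished S≡[] _) (step-free {xs = xs} _ _ _ _ _ _ _ _) =
    ⊥-elim (++-∷≢[] xs S≡[])
  step-invariant (pending S≡[e] pq pce below)
                 (step-conflict {χ = χ} {xs = xs} {ys} {i = i} se u≺v ℓᵤ 1≤c c≤ c∉Cᵤ c∉Cᵥ uw χuw)
    with refl , refl , refl ← ++-∷≡-singleton xs ys S≡[e] =
    pred i , pred-< (proj₁ ℓᵤ) level≤ ,
    pending refl uw (recolor-shift G Q except adjacent in-palette free-head χuw)
            (λ _ ℓw → inj₂ (<⇒≤pred (level-<-of-∉ ℓᵤ ℓw w∉Zᵢ)))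
    where
    open Selected (selected pq pce below se u≺v ℓᵤ 1≤c c≤ c∉Cᵥ)
    w∉Zᵢ = λ w∈Zᵢ → c∉Cᵤ (∈-colorsAt G χ w∈Zᵢ uw χuw)
  step-invariant {m} (pending S≡[e] pq pce below)
                 (step-free {χ = χ} {xs = xs} {ys} se u≺v ℓᵤ 1≤c c≤ _ c∉Cᵥ no-conflict)
    with refl , refl , refl ← ++-∷≡-singleton xs ys S≡[e] =
    pred m , pred-< (≤-trans (proj₁ ℓᵤ) level≤) ≤-refl ,
    finished refl (recolor-free G Q except adjacent in-palette
                     (λ z χuz → no-conflict z (colored⇒adj G (proj₁ except) χuz) χuz) free-head)
    where open Selected (selected pq pce below se u≺v ℓᵤ 1≤c c≤ c∉Cᵥ)

  progress : ∀ {m χ S} → Invariant m (χ , S) → S ≢ [] → ∃₂ λ f s′ → Step (χ , S) f s′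
  progress (finished S≡[] _) S≢[] = ⊥-elim (S≢[] S≡[])
  progress {χ = χ} (pending refl pq _ _) _
    with u , v , se , u≺v ← oriented pq
    with i , ℓᵤ ← level u
    with c , 1≤c , c≤ , c∉Cᵤ , c∉Cᵥ ← fresh-color₂ (colorsAt G χ u (Z i)) (colorsAt G χ v ⊤)
    with any? (λ w → T? (adj G u w) ×-dec Maybe.≡-dec ℕ._≟_ (χ u w) (just c))
  ... | yes (w , uw , χuw) = _ , _ , step-conflict {xs = []} {ys = []} se u≺v ℓᵤ 1≤c c≤ c∉Cᵤ c∉Cᵥ uw χuw
  ... | no no-conflict     = _ , _ , step-free {xs = []} {ys = []} se u≺v ℓᵤ 1≤c c≤ c∉Cᵤ c∉Cᵥ
                                       (λ w uw χuw → no-conflict (w , uw , χuw))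

  accessible : ∀ m {s} → Invariant m s → Acc Successor s
  accessible = <-rec (λ m → ∀ {s} → Invariant m s → Acc Successor s)
    λ m rec inv → acc λ (_ , step) → let m′ , m′<m , inv′ = step-invariant inv step in rec m′<m inv′

  run-invariant : ∀ {m s fs s′} → Invariant m s → Run s fs s′ →
                  ∃ λ m′ → length fs + m′ ≤ m × Invariant m′ s′
  run-invariant {m} inv done = m , ≤-refl , inv
  run-invariant inv (next step run) with m₁ , m₁<m , inv₁ ← step-invariant inv step
    with m′ , bound , inv′ ← run-invariant inv₁ run = m′ , ≤-trans (s≤s bound) m₁<m , inv′

  extendColoring-correct : ∀ {a b χ} → T (adj G a b) → IsProperColoringExcept G (a , b) Q χ →
                           ExtendColoringCorrect G L Z _≺_ Q (a , b) χ
  extendColoring-correct {a} {b} {χ} ab pce = accessible L start , stuck-free , final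
    where
    start : Invariant L (χ , [ (a , b) ])
    start = pending refl ab pce (λ ℓa _ → inj₁ (proj₁ (proj₂ ℓa)))
    stuck-free : ∀ fs s → Run (χ , [ (a , b) ]) fs s → proj₂ s ≢ [] → ∃₂ λ f s′ → Step s f s′
    stuck-free _ _ run S≢[] = progress (proj₂ (proj₂ (run-invariant start run))) S≢[]
    final : ∀ fs s → Run (χ , [ (a , b) ]) fs s → proj₂ s ≡ [] → distinctEdges G fs ≤ L × IsProperColoring G Q (proj₁ s)
    final fs s run S≡[] with run-invariant start run
    ... | _ , bound , finished _ proper =
      ≤-trans (distinctEdges-≤ G fs) (≤-trans (m≤m+n _ _) bound) , proper
    ... | _ , _ , pending S≡[e] _ _ _ with () ← trans (sym S≡[]) S≡[e]

-- Rational bounds from the parameters of the decomposition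

ℕtoℚ≡mkℚ : ∀ m → ℕtoℚ m ≡ mkℚ (ℤ.+ m) 0 (Coprime.sym (Coprime.1-coprimeTo m))
ℕtoℚ≡mkℚ m = ℚ.normalize-coprime (Coprime.sym (Coprime.1-coprimeTo m))

ℕtoℚ-+ : ∀ m n → ℕtoℚ (m + n) ≡ ℕtoℚ m ℚ.+ ℕtoℚ n
ℕtoℚ-+ m n = trans (ℚ./-cong {ℤ.+ (m + n)} {1}
                     (cong₂ ℤ._+_ (sym (ℤ.*-identityʳ (ℤ.+ m))) (sym (ℤ.*-identityʳ (ℤ.+ n)))) refl)
                   (sym (cong₂ ℚ._+_ (ℕtoℚ≡mkℚ m) (ℕtoℚ≡mkℚ n)))

ℕtoℚ-* : ∀ m n → ℕtoℚ (m * n) ≡ ℕtoℚ m ℚ.* ℕtoℚ n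
ℕtoℚ-* m n = trans (ℚ./-cong {ℤ.+ (m * n)} {1} (ℤ.pos-* m n) refl)
                   (sym (cong₂ ℚ._*_ (ℕtoℚ≡mkℚ m) (ℕtoℚ≡mkℚ n)))

ℕtoℚ-mono-≤ : ∀ {m n} → m ≤ n → ℕtoℚ m ℚ.≤ ℕtoℚ n
ℕtoℚ-mono-≤ {m} {n} m≤n rewrite ℕtoℚ≡mkℚ m | ℕtoℚ≡mkℚ n =
  *≤* (subst₂ ℤ._≤_ (sym (ℤ.*-identityʳ (ℤ.+ m))) (sym (ℤ.*-identityʳ (ℤ.+ n))) (+≤+ m≤n))

ℕtoℚ-pos : ∀ {m} → 1 ≤ m → ℚ.Positive (ℕtoℚ m)
ℕtoℚ-pos {suc m} _ = ℚ.normalize-pos (suc m) 1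

-- If floor q < c then ↥ q < (floor q + 1) ↧ q ≤ c ↧ q ≤ ↥ q.
ℕtoℚ-≤⇒≤floor : ∀ c q → ℕtoℚ c ℚ.≤ q → ℤ.+ c ℤ.≤ ℚ.floor q
ℕtoℚ-≤⇒≤floor c q@(mkℚ num den-1 _) c≤q rewrite ℕtoℚ≡mkℚ c with c≤q
... | *≤* c*den≤num = ℤ.≮⇒≥ λ ⌊q⌋<c → ℤ.<-irrefl refl
  (ℤ.<-≤-trans (ℤ.n<s[n/ℕd]*d num den)
     (ℤ.≤-trans (ℤ.*-monoʳ-≤-nonNeg (ℤ.+ den)
                   (subst (λ z → ℤ.suc z ℤ.≤ ℤ.+ c) (ℤ.div-pos-is-/ℕ num den) (ℤ.i<j⇒suc[i]≤j ⌊q⌋<c)))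
                (subst (ℤ.+ c ℤ.* ℤ.+ den ℤ.≤_) (ℤ.*-identityʳ num) c*den≤num)))
  where den = suc den-1

∑-ℕtoℚ-* : ∀ {n} (f g : Fin n → ℕ) d → (∀ i → ℕtoℚ (f i) ℚ.* d ℚ.≤ ℕtoℚ (g i)) →
           ℕtoℚ (∑[ i < n ] f i) ℚ.* d ℚ.≤ ℕtoℚ (∑[ i < n ] g i)
∑-ℕtoℚ-* {zero}  f g d _   = ℚ.≤-reflexive (ℚ.*-zeroˡ d)
∑-ℕtoℚ-* {suc n} f g d f≤g = begin
  ℕtoℚ (f Fin.zero + ∑[ i < n ] f (Fin.suc i)) ℚ.* d
    ≡⟨ trans (cong (ℚ._* d) (ℕtoℚ-+ (f Fin.zero) _)) (ℚ.*-distribʳ-+ d (ℕtoℚ (f Fin.zero)) _) ⟩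
  ℕtoℚ (f Fin.zero) ℚ.* d ℚ.+ ℕtoℚ (∑[ i < n ] f (Fin.suc i)) ℚ.* d
    ≤⟨ ℚ.+-mono-≤ (f≤g Fin.zero) (∑-ℕtoℚ-* (f ∘ Fin.suc) (g ∘ Fin.suc) d (f≤g ∘ Fin.suc)) ⟩
  ℕtoℚ (g Fin.zero) ℚ.+ ℕtoℚ (∑[ i < n ] g (Fin.suc i))
    ≡⟨ ℕtoℚ-+ (g Fin.zero) _ ⟨
  ℕtoℚ (g Fin.zero + ∑[ i < n ] g (Fin.suc i)) ∎
  where open ℚ.≤-Reasoning

module Decomposition (ε : ℚ) (0<ε : 0ℚ < ε) (n k : ℕ) (⌈log⌉ : IsCeilLog (1ℚ ℚ.+ ε) n k)
  (G : Graph n) (α : ℕ) (arboricity : ArboricityAtMost G α) {a b : Fin n} (ab : T (adj G a b))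
  (Z : ℕ → Subset n) (decomposition : IsDecomposition G (β ε) (dval ε α) (2 + k) Z) where

  L : ℕ
  L = 2 + k

  ρ : ℚ
  ρ = 1ℚ ℚ.+ ε

  d : ℚ
  d = dval ε α

  Z₁≡⊤ : Z 1 ≡ ⊤
  Z₁≡⊤ = proj₁ decomposition

  Z-antitone : ∀ i → 1 ≤ i → i ℕ.< L → Z (suc i) ⊆ Z i
  Z-antitone = proj₁ (proj₂ decomposition)

  private
    a′ : ℕ
    a′ = proj₁ arboricity

    a′-bound : ArbBound G a′
    a′-bound = proj₁ (proj₁ (proj₂ arboricity))

    a′≤α : a′ ≤ α
    a′≤α = proj₂ (proj₂ arboricity)

    high-stays : ∀ i → 1 ≤ i → i ℕ.< L → ∀ u → u ∈ Z i →
                 β ε ℚ.* d < ℕtoℚ (degIn G (Z i) u) → u ∈ Z (suc i)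
    high-stays = proj₁ (proj₂ (proj₂ decomposition))

    low-leaves : ∀ i → 1 ≤ i → i ℕ.< L → ∀ u → u ∈ Z i → ℕtoℚ (degIn G (Z i) u) < d → u ∉ Z (suc i)
    low-leaves = proj₂ (proj₂ (proj₂ decomposition))

  1<ρ : 1ℚ < ρ
  1<ρ = ℚ.≤-<-trans (ℚ.≤-reflexive (sym (ℚ.+-identityʳ 1ℚ))) (ℚ.+-monoʳ-< 1ℚ 0<ε)

  1-pos : ℚ.Positive 1ℚ
  1-pos = ℕtoℚ-pos {1} (s≤s z≤n)

  ρ-pos : ℚ.Positive ρ
  ρ-pos = ℚ.positive (ℚ.<-trans (ℚ.positive⁻¹ 1ℚ {{1-pos}}) 1<ρ)

  pow-pos : ∀ j → ℚ.Positive (pow ρ j)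
  pow-pos zero    = 1-pos
  pow-pos (suc j) = ℚ.pos*pos⇒pos ρ {{ρ-pos}} (pow ρ j) {{pow-pos j}}

  pow-nonNeg : ∀ j → ℚ.NonNegative (pow ρ j)
  pow-nonNeg j = ℚ.pos⇒nonNeg (pow ρ j) {{pow-pos j}}

  -- The vertices kept in Z (i + 1) have degree at least d = 2 (1 + ε) α in G[Z i], whose degree
  -- sum is at most 2 α (∣ Z i ∣ - 1) by the arboricity bound; divide by 2 α.
  Z-shrinks : ∀ i → 1 ≤ i → i ℕ.< L → ℕtoℚ ∣ Z (suc i) ∣ ℚ.* ρ ℚ.≤ ℕtoℚ ∣ Z i ∣
  Z-shrinks i 1≤i i<L = ℚ.≤-trans (ℚ.*-cancelˡ-≤-pos (ℕtoℚ (2 * α)) {{ℕtoℚ-pos 1≤2α}} (begin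
    ℕtoℚ (2 * α) ℚ.* (ℕtoℚ t ℚ.* ρ)    ≡⟨ scale ⟨
    ℕtoℚ t ℚ.* d                       ≤⟨ subst (λ z → ℕtoℚ z ℚ.* d ℚ.≤ ℕtoℚ degrees) (sym (∣∣≡∑ (Z (suc i))))
                                                (∑-ℕtoℚ-* (𝟙 ∘ lookup (Z (suc i))) _ d survivor-degree) ⟩
    ℕtoℚ degrees                       ≤⟨ ℕtoℚ-mono-≤ (≤-trans (degreeSum-≤ G a′-bound (Z-antitone i 1≤i i<L))
                                                              (*-monoʳ-≤ 2 (*-monoˡ-≤ s′ a′≤α))) ⟩
    ℕtoℚ (2 * (α * s′))                ≡⟨ trans (cong ℕtoℚ (sym (*-assoc 2 α s′))) (ℕtoℚ-* (2 * α) s′) ⟩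
    ℕtoℚ (2 * α) ℚ.* ℕtoℚ s′           ∎)) (ℕtoℚ-mono-≤ (m∸n≤m ∣ Z i ∣ 1))
    where
    open ℚ.≤-Reasoning
    open +-*-Solver
    t  = ∣ Z (suc i) ∣
    s′ = ∣ Z i ∣ ∸ 1
    degrees = degreeSum G (Z (suc i)) (Z i)
    1≤2α = ≤-trans (≤-trans (arboricity-pos G a′-bound ab) a′≤α) (m≤m+n α _)
    scale : ℕtoℚ t ℚ.* d ≡ ℕtoℚ (2 * α) ℚ.* (ℕtoℚ t ℚ.* ρ)
    scale = trans (solve 4 (λ t two r a → t :* ((two :* r) :* a) := (two :* a) :* (t :* r))
                           refl (ℕtoℚ t) (ℕtoℚ 2) ρ (ℕtoℚ α))
                  (cong (ℚ._* (ℕtoℚ t ℚ.* ρ)) (sym (ℕtoℚ-* 2 α)))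
    survivor-degree : ∀ x → ℕtoℚ (𝟙 (lookup (Z (suc i)) x)) ℚ.* d ℚ.≤
                            ℕtoℚ (if lookup (Z (suc i)) x then degIn G (Z i) x else 0)
    survivor-degree x with lookup (Z (suc i)) x in x∈Zᵢ₊₁
    ... | false = ℚ.≤-reflexive (ℚ.*-zeroˡ d)
    ... | true  = ℚ.≤-trans (ℚ.≤-reflexive (ℚ.*-identityˡ d)) (ℚ.≮⇒≥ λ deg<d →
      low-leaves i 1≤i i<L x (Z-antitone i 1≤i i<L x∈) deg<d x∈)
      where x∈ = lookup⇒[]= x (Z (suc i)) x∈Zᵢ₊₁

  Z-size : ∀ j → suc j ≤ L → ℕtoℚ ∣ Z (suc j) ∣ ℚ.* pow ρ j ℚ.≤ ℕtoℚ n
  Z-size zero    _ =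
    ℚ.≤-reflexive (trans (ℚ.*-identityʳ _) (cong ℕtoℚ (trans (cong ∣_∣ Z₁≡⊤) (∣⊤∣≡n n))))
  Z-size (suc j) j+2≤L = begin
    ℕtoℚ ∣ Z (2 + j) ∣ ℚ.* (ρ ℚ.* pow ρ j)  ≡⟨ ℚ.*-assoc (ℕtoℚ ∣ Z (2 + j) ∣) ρ (pow ρ j) ⟨
    ℕtoℚ ∣ Z (2 + j) ∣ ℚ.* ρ ℚ.* pow ρ j    ≤⟨ ℚ.*-monoʳ-≤-nonNeg (pow ρ j) {{pow-nonNeg j}}
                                                  (Z-shrinks (suc j) (s≤s z≤n) j+2≤L) ⟩
    ℕtoℚ ∣ Z (suc j) ∣ ℚ.* pow ρ j          ≤⟨ Z-size j (≤-trans (n≤1+n _) j+2≤L) ⟩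
    ℕtoℚ n                                  ∎
    where open ℚ.≤-Reasoning

  Z-top-empty : ∀ u → u ∉ Z L
  Z-top-empty u u∈Z_L = ℚ.<-irrefl refl (begin-strict
    pow ρ (suc k)                          ≡⟨ ℚ.*-identityˡ _ ⟨
    1ℚ ℚ.* pow ρ (suc k)                   ≤⟨ ℚ.*-monoʳ-≤-nonNeg (pow ρ (suc k)) {{pow-nonNeg (suc k)}}
                                                (ℕtoℚ-mono-≤ {1} (≤-trans (s≤s z≤n) (x∈p⇒∣p-x∣<∣p∣ u∈Z_L))) ⟩
    ℕtoℚ ∣ Z L ∣ ℚ.* pow ρ (suc k)         ≤⟨ Z-size (suc k) ≤-refl ⟩
    ℕtoℚ n                                 ≤⟨ proj₁ ⌈log⌉ ⟩
    pow ρ k                                ≡⟨ ℚ.*-identityˡ _ ⟨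
    1ℚ ℚ.* pow ρ k                         <⟨ ℚ.*-monoˡ-<-pos (pow ρ k) {{pow-pos k}} 1<ρ ⟩
    pow ρ (suc k)                          ∎)
    where open ℚ.≤-Reasoning

  level-<-top : ∀ {u i} → IsLevel L Z u i → i ℕ.< L
  level-<-top {u} (_ , i≤L , u∈Zᵢ , _) with m≤n⇒m<n∨m≡n i≤L
  ... | inj₁ i<L  = i<L
  ... | inj₂ refl = ⊥-elim (Z-top-empty u u∈Zᵢ)

  level-degree-≤ : ∀ {u i} → IsLevel L Z u i → ℕtoℚ (degIn G (Z i) u) ℚ.≤ β ε ℚ.* d
  level-degree-≤ {u} {i} ℓ@(1≤i , _ , u∈Zᵢ , u∉Zᵢ₊₁) =
    ℚ.≮⇒≥ λ βd<deg → u∉Zᵢ₊₁ (level-<-top ℓ) (high-stays i 1≤i (level-<-top ℓ) u u∈Zᵢ βd<deg)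

  in-palette : ∀ Δ {u i} → IsLevel L Z u i → ∀ {c} → 1 ≤ c → c ≤ degIn G (Z i) u + Δ →
               InPalette (paletteBound ε Δ α) c
  in-palette Δ {u} {i} ℓ {c} 1≤c c≤ = 1≤c , ℕtoℚ-≤⇒≤floor c _ (begin
    ℕtoℚ c                                  ≤⟨ ℕtoℚ-mono-≤ c≤ ⟩
    ℕtoℚ (degIn G (Z i) u + Δ)              ≡⟨ ℕtoℚ-+ (degIn G (Z i) u) Δ ⟩
    ℕtoℚ (degIn G (Z i) u) ℚ.+ ℕtoℚ Δ       ≤⟨ ℚ.+-monoˡ-≤ (ℕtoℚ Δ) (level-degree-≤ ℓ) ⟩
    β ε ℚ.* d ℚ.+ ℕtoℚ Δ                    ≡⟨ solve 5 (λ b two r a D → b :* ((two :* r) :* a) :+ D :=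
                                                                   D :+ (((two :* b) :* r) :* a))
                                                     refl (β ε) (ℕtoℚ 2) ρ (ℕtoℚ α) (ℕtoℚ Δ) ⟩
    paletteBound ε Δ α                      ∎)
    where
    open ℚ.≤-Reasoning
    open +-*-Solver

lemma3p2 : (ε : ℚ) → 0ℚ < ε → ε < 1ℚ →
    (n k : ℕ) → IsCeilLog (1ℚ ℚ.+ ε) n k →
    (G : Graph n) (Δ α : ℕ) → MaxDegreeAtMost G Δ → ArboricityAtMost G α →
    (a b : Fin n) → T (adj G a b) →
    (Z : ℕ → Subset n) → IsDecomposition G (β ε) (dval ε α) (2 + k) Z →
    (_≺_ : Fin n → Fin n → Set) → IsOrientation G (2 + k) Z _≺_ →
    (χ : Coloring n) → IsProperColoringExcept G (a , b) (paletteBound ε Δ α) χ →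
    ExtendColoringCorrect G (2 + k) Z _≺_ (paletteBound ε Δ α) (a , b) χ
lemma3p2 ε 0<ε _ n k ⌈log⌉ G Δ α max-degree arboricity a b ab Z decomposition _≺_ orientation χ except =
  extendColoring-correct ab except
  where
  open Decomposition ε 0<ε n k ⌈log⌉ G α arboricity ab Z decomposition
  open Correctness G (2 + k) Z _≺_ (paletteBound ε Δ α) Δ orientation (s≤s z≤n) Z₁≡⊤ Z-antitone
                   max-degree (in-palette Δ)
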